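{- Let $\rho\ge1$ and let $(D,T,k)$ be an instance of SFAST with a regular order $\sigma=(v_1,\dots,v_n)$ of $V(D)$ satisfying $\mathrm{cost}(\sigma)\le\rho k$, and suppose the instance is reduced with respect to $\sigma$. Let $t=v_i$ be a terminal and $e$ an affected arc above $t$ with span $[v_l,v_r]$. Then, with $\ell=2(\rho+1)k+2$, either $l\le i\le l+\ell$ or $r-\ell\le i\le r$.
   Context: A $T$-cycle is a directed cycle through a vertex of $T$. For an order $\sigma=(v_1,\dots,v_n)$: the interval $[v_a,v_b]=\{v_m:a\le m\le b\}$; a non-terminal interval contains no vertex of $T$; an arc $v_av_b$ is forward if $a<b$, backward if $b<a$; the span of a backward arc $v_av_b$ is $[v_b,v_a]$ and the arc is above each vertex of its span; a backward arc above some terminal is affected; $\mathrm{cost}(\sigma)$ is the number of affected arcs. $\sigma$ is regular if for every non-terminal interval $I=[v_a,v_b]$, $|N^+_I(v_a)|\ge\lceil(b-a)/2\rceil$ and $|N^-_I(v_b)|\ge\lceil(b-a)/2\rceil$ (out-/in-neighbours inside $I$). The instance is reduced w.r.t. $\sigma$ if: it is not the case that $k\le0$ and $D$ has a $T$-cycle; it is not the case that $k\ge0$ and $D$ has no $T$-cycle; every vertex lies on some $T$-cycle; and there is no affected arc $uv$ above a terminal $t'$ such that there are $k+1$ pairwise arc-disjoint paths from $v$ to $u$, each containing $t'$ and consisting only of forward arcs.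
   Formalization: The parameter ρ ranges over the rationals with ρ ≥ 1, so the bound ρk on cost(σ) and the quantity ℓ are computed in ℚ. -}

module Defs where

open import Data.Nat as ℕ using (ℕ; zero; suc; _≤_; _<_; ⌈_/2⌉; _∸_)
open import Data.Integer as ℤ using (ℤ; +_)
open import Data.Rational as ℚ using (ℚ)
open import Data.Fin using (Fin; toℕ) renaming (zero to fz; suc to fs)
open import Data.Bool using (Bool; true; false; if_then_else_; _∧_)
open import Data.List using (List; []; _∷_; length)
open import Data.List.Membership.Propositional using (_∈_)
open import Data.List.Relation.Unary.Unique.Propositional using (Unique)
open import Data.List.Relation.Unary.AllPairs using (AllPairs)
open import Data.Product using (_×_; _,_; ∃; ∃-syntax; Σ-syntax)
open import Data.Sum using (_⊎_)
open import Data.Empty using (⊥)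
open import Relation.Nullary using (¬_)
open import Relation.Binary.PropositionalEquality using (_≡_; _≢_)
open import Function using (_∘_)
open import Function.Definitions using (Injective)

-- A digraph on vertex set Fin n, given by a Boolean adjacency function:
-- A u v ≡ true  iff  uv is an arc.
Adj : ℕ → Set
Adj n = Fin n → Fin n → Bool

IsTournament : ∀ {n} → Adj n → Set
IsTournament {n} A =
  (∀ v → A v v ≡ false) ×
  (∀ u v → u ≢ v → (A u v ≡ true × A v u ≡ false) ⊎ (A u v ≡ false × A v u ≡ true))

data Walk {n} (A : Adj n) : List (Fin n) → Set where
  one  : ∀ x → Walk A (x ∷ [])
  cons : ∀ x y ys → A x y ≡ true → Walk A (y ∷ ys) → Walk A (x ∷ y ∷ ys)

last : ∀ {a} {X : Set a} → X → List X → X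
last x [] = x
last x (y ∷ ys) = last y ys

IsCycle : ∀ {n} → Adj n → List (Fin n) → Set
IsCycle A [] = ⊥
IsCycle A (x ∷ xs) = Unique (x ∷ xs) × Walk A (x ∷ xs) × A (last x xs) x ≡ true

Subset : ℕ → Set
Subset n = Fin n → Bool

IsTCycle : ∀ {n} → Adj n → Subset n → List (Fin n) → Set
IsTCycle A T C = IsCycle A C × ∃[ t ] (t ∈ C × T t ≡ true)

HasTCycle : ∀ {n} → Adj n → Subset n → Set
HasTCycle A T = ∃[ C ] IsTCycle A T C

-- Orders.  An order σ = (v_0,…,v_{n-1}) of V(D) is an injective (hence
-- bijective) map σ : Fin n → Fin n, σ m = v_m.  Below, positions are Fin n
-- and all notions are expressed on positions.

Arcσ : ∀ {n} → Adj n → (Fin n → Fin n) → Fin n → Fin n → Bool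
Arcσ A σ a b = A (σ a) (σ b)

sumF : ∀ n → (Fin n → ℕ) → ℕ
sumF zero f = 0
sumF (suc n) f = f fz ℕ.+ sumF n (f ∘ fs)

count : ∀ n → (Fin n → Bool) → ℕ
count n p = sumF n (λ m → if p m then 1 else 0)

inIv : ∀ {n} → Fin n → Fin n → Fin n → Bool
inIv a b m = (toℕ a ℕ.≤ᵇ toℕ m) ∧ (toℕ m ℕ.≤ᵇ toℕ b)

NonTerminal : ∀ {n} → Subset n → (Fin n → Fin n) → Fin n → Fin n → Set
NonTerminal T σ a b = ∀ m → toℕ a ≤ toℕ m → toℕ m ≤ toℕ b → T (σ m) ≡ false

Regular : ∀ {n} → Adj n → Subset n → (Fin n → Fin n) → Set
Regular {n} A T σ = ∀ a b → toℕ a ≤ toℕ b → NonTerminal T σ a b →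
  (⌈ (toℕ b ∸ toℕ a) /2⌉ ≤ count n (λ m → inIv a b m ∧ Arcσ A σ a m)) ×
  (⌈ (toℕ b ∸ toℕ a) /2⌉ ≤ count n (λ m → inIv a b m ∧ Arcσ A σ m b))

terminalIn : ∀ {n} → Subset n → (Fin n → Fin n) → Fin n → Fin n → Bool
terminalIn {n} T σ b a with count n (λ m → inIv b a m ∧ T (σ m))
... | zero = false
... | suc _ = true

affected : ∀ {n} → Adj n → Subset n → (Fin n → Fin n) → Fin n → Fin n → Bool
affected A T σ a b = Arcσ A σ a b ∧ (toℕ b ℕ.<ᵇ toℕ a) ∧ terminalIn T σ b a

cost : ∀ {n} → Adj n → Subset n → (Fin n → Fin n) → ℕ
cost {n} A T σ = sumF n (λ a → count n (λ b → affected A T σ a b))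

data FwdPath {n} (A : Adj n) (σ : Fin n → Fin n) : Fin n → Fin n → List (Fin n) → Set where
  here : ∀ x → FwdPath A σ x x (x ∷ [])
  step : ∀ {x y z p} → Arcσ A σ x y ≡ true → toℕ x < toℕ y →
         FwdPath A σ y z p → FwdPath A σ x z (x ∷ p)

arcsOf : ∀ {n} → List (Fin n) → List (Fin n × Fin n)
arcsOf (x ∷ y ∷ r) = (x , y) ∷ arcsOf (y ∷ r)
arcsOf _ = []

ArcDisjoint : ∀ {n} → List (Fin n) → List (Fin n) → Set
ArcDisjoint P Q = ∀ e → e ∈ arcsOf P → e ∈ arcsOf Q → ⊥

Reduced : ∀ {n} → Adj n → Subset n → ℤ → (Fin n → Fin n) → Set
Reduced {n} A T k σ =
  ¬ (k ℤ.≤ + 0 × HasTCycle A T) ×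
  ¬ (+ 0 ℤ.≤ k × ¬ HasTCycle A T) ×
  (∀ v → ∃[ C ] (IsTCycle A T C × v ∈ C)) ×
  (∀ a b m → Arcσ A σ a b ≡ true → toℕ b < toℕ a →
     toℕ b ≤ toℕ m → toℕ m ≤ toℕ a → T (σ m) ≡ true →
     ¬ (Σ[ Ps ∈ List (List (Fin n)) ]
          ((+ length Ps ≡ k ℤ.+ + 1) ×
           (∀ P → P ∈ Ps → FwdPath A σ b a P × m ∈ P) ×
           AllPairs ArcDisjoint Ps)))

ℕ→ℚ : ℕ → ℚ
ℕ→ℚ m = + m ℚ./ 1

ℤ→ℚ : ℤ → ℚ
ℤ→ℚ z = z ℚ./ 1

-- Let a < b be positions one of which holds a terminal, let d be the number of positions strictly
-- between them, and call x a detour from a to b if a < x < b and a → x → b. If x is not a detour,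
-- one of the arcs a x, x b is reversed; the reversed arc is backward, hence affected unless the
-- interval it spans contains no terminal, and regularity of σ at the outermost vertex of that
-- second kind shows there are at most ⌊d/2⌋ of them. Hence ⌈d/2⌉ ≤ #detours + cost(σ), and with
-- cost(σ) ≤ ρk, more than 2(ρ+1)k positions on each side of t give k+1 detours x from v_l to t and
-- k+1 detours y from t to v_r. The paths v_l x t y v_r are forward, pass through t, and are
-- pairwise arc-disjoint since distinct paths differ in both x and y; a reduced instance has no
-- such family below the affected arc v_r v_l. A negative k is excluded because every vertex lies
-- on a T-cycle.
module Submission where

open import Defs
open import Data.Fin using (Fin; toℕ)

module Counting where

  open import Data.Nat using (ℕ; zero; suc; _+_; _∸_; _≤_; _<_; z≤n; s≤s; _<ᵇ_; ⌊_/2⌋; ⌈_/2⌉)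
  open import Data.Nat.Properties
  open import Data.Bool using (Bool; true; false; if_then_else_; _∧_; _∨_; not)
  open import Data.Bool.Properties using (∨-zeroʳ; not-injective)
  open import Data.Fin using () renaming (zero to fz; suc to fs)
  open import Data.Fin.Properties using () renaming (suc-injective to fs-injective)
  open import Data.Product using (Σ-syntax; _×_; _,_)
  open import Data.Sum using (_⊎_; inj₁; inj₂)
  open import Function using (_∘_)
  open import Function.Definitions using (Injective)
  open import Relation.Nullary using (¬_; contradiction)
  open import Relation.Nullary.Reflects using (Reflects; ofʸ; ofⁿ)
  open import Relation.Binary.PropositionalEquality
  open import Algebra.Properties.CommutativeSemigroup +-commutativeSemigroup using (interchange; x∙yz≈y∙xz)

  true⇒P : ∀ {P : Set} {b} → Reflects P b → b ≡ true → P
  true⇒P (ofʸ p) refl = p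

  false⇒¬P : ∀ {P : Set} {b} → Reflects P b → b ≡ false → ¬ P
  false⇒¬P (ofⁿ ¬p) refl = ¬p

  P⇒true : ∀ {P : Set} {b} → Reflects P b → P → b ≡ true
  P⇒true (ofʸ _) _ = refl
  P⇒true (ofⁿ ¬p) p = contradiction p ¬p

  ¬P⇒false : ∀ {P : Set} {b} → Reflects P b → ¬ P → b ≡ false
  ¬P⇒false (ofʸ p) ¬p = contradiction p ¬p
  ¬P⇒false (ofⁿ _) _ = refl

  ∧-true : ∀ a {b} → a ∧ b ≡ true → a ≡ true × b ≡ true
  ∧-true true b≡true = refl , b≡true

  case-bool : ∀ {P : Set} b → (b ≡ true → P) → (b ≡ false → P) → P
  case-bool true  t f = t refl
  case-bool false t f = f refl

  ∨-introˡ : ∀ a b → a ≡ true → a ∨ b ≡ true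
  ∨-introˡ a b refl = refl

  ∨-introʳ : ∀ a b → b ≡ true → a ∨ b ≡ true
  ∨-introʳ a b refl = ∨-zeroʳ a

  sumF-mono : ∀ n {f g : Fin n → ℕ} → (∀ m → f m ≤ g m) → sumF n f ≤ sumF n g
  sumF-mono zero    f≤g = z≤n
  sumF-mono (suc n) f≤g = +-mono-≤ (f≤g fz) (sumF-mono n (f≤g ∘ fs))

  sumF-+ : ∀ n (f g : Fin n → ℕ) → sumF n (λ m → f m + g m) ≡ sumF n f + sumF n g
  sumF-+ zero    f g = refl
  sumF-+ (suc n) f g = trans (cong (f fz + g fz +_) (sumF-+ n (f ∘ fs) (g ∘ fs)))
                             (interchange (f fz) (g fz) (sumF n (f ∘ fs)) (sumF n (g ∘ fs)))

  term+sumF≤sumF : ∀ n (f g : Fin n → ℕ) i → g i ≡ 0 → (∀ m → g m ≤ f m) → f i + sumF n g ≤ sumF n f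
  term+sumF≤sumF (suc n) f g fz     gᵢ≡0 g≤f rewrite gᵢ≡0 = +-monoʳ-≤ (f fz) (sumF-mono n (g≤f ∘ fs))
  term+sumF≤sumF (suc n) f g (fs i) gᵢ≡0 g≤f = begin
    f (fs i) + (g fz + sumF n (g ∘ fs)) ≡⟨ x∙yz≈y∙xz (f (fs i)) (g fz) _ ⟩
    g fz + (f (fs i) + sumF n (g ∘ fs)) ≤⟨ +-mono-≤ (g≤f fz) (term+sumF≤sumF n (f ∘ fs) (g ∘ fs) i gᵢ≡0 (g≤f ∘ fs)) ⟩
    f fz + sumF n (f ∘ fs)              ∎
    where open ≤-Reasoning

  sumF-term : ∀ n (f : Fin n → ℕ) i → f i ≤ sumF n f
  sumF-term n f i = ≤-trans (m≤m+n (f i) _) (term+sumF≤sumF n f (λ _ → 0) i refl (λ _ → z≤n))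

  count-mono : ∀ n {p q : Fin n → Bool} → (∀ m → p m ≡ true → q m ≡ true) → count n p ≤ count n q
  count-mono n {p} {q} p⊆q = sumF-mono n pointwise
    where
    pointwise : ∀ m → (if p m then 1 else 0) ≤ (if q m then 1 else 0)
    pointwise m with p m in pm
    ... | false = z≤n
    ... | true rewrite p⊆q m pm = ≤-refl

  count-∨ : ∀ n (p q : Fin n → Bool) → count n (λ m → p m ∨ q m) ≤ count n p + count n q
  count-∨ n p q = subst (count n (λ m → p m ∨ q m) ≤_) (sumF-+ n _ _) (sumF-mono n (λ m → pointwise (p m) (q m)))
    where
    pointwise : ∀ a b → (if a ∨ b then 1 else 0) ≤ (if a then 1 else 0) + (if b then 1 else 0)
    pointwise true  b = s≤s z≤n
    pointwise false b = ≤-refl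

  count-∨-disjoint : ∀ n (p q : Fin n → Bool) → (∀ m → p m ≡ true → q m ≡ false) →
                     count n p + count n q ≤ count n (λ m → p m ∨ q m)
  count-∨-disjoint n p q p∩q=∅ = subst (_≤ count n (λ m → p m ∨ q m)) (sumF-+ n _ _) (sumF-mono n pointwise)
    where
    pointwise : ∀ m → (if p m then 1 else 0) + (if q m then 1 else 0) ≤ (if p m ∨ q m then 1 else 0)
    pointwise m with p m in pm
    ... | false = ≤-refl
    ... | true rewrite p∩q=∅ m pm = ≤-refl

  count-pos : ∀ n (p : Fin n → Bool) m → p m ≡ true → 0 < count n p
  count-pos n p m pm = subst (λ b → (if b then 1 else 0) ≤ count n p) pm (sumF-term n _ m)

  count-none : ∀ n (p : Fin n → Bool) → (∀ m → p m ≡ false) → count n p ≡ 0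
  count-none zero    p none = refl
  count-none (suc n) p none rewrite none fz = count-none n (p ∘ fs) (none ∘ fs)

  -- The lower bound is tested with _<ᵇ_ as well, so that count-Ico goes through by reduction.
  Ico : ∀ {n} → ℕ → ℕ → Fin n → Bool
  Ico lo hi m = (toℕ m <ᵇ hi) ∧ not (toℕ m <ᵇ lo)

  Ico-intro : ∀ {n} lo hi {m : Fin n} → lo ≤ toℕ m → toℕ m < hi → Ico lo hi m ≡ true
  Ico-intro lo hi lo≤m m<hi = cong₂ _∧_ (P⇒true (<ᵇ-reflects-< _ _) m<hi) (cong not (¬P⇒false (<ᵇ-reflects-< _ _) (≤⇒≯ lo≤m)))

  Ico-elim : ∀ {n} lo hi {m : Fin n} → Ico lo hi m ≡ true → lo ≤ toℕ m × toℕ m < hi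
  Ico-elim lo hi {m} m∈ with ∧-true (toℕ m <ᵇ hi) m∈
  ... | m<hi , m≮lo = ≮⇒≥ (false⇒¬P (<ᵇ-reflects-< _ _) (not-injective m≮lo)) , true⇒P (<ᵇ-reflects-< _ _) m<hi

  count-Ico : ∀ n lo hi → hi ≤ n → count n (Ico lo hi) ≡ hi ∸ lo
  count-Ico n       lo       zero     _          = trans (count-none n _ (λ _ → refl)) (sym (0∸n≡0 lo))
  count-Ico (suc n) zero     (suc hi) (s≤s hi≤n) = cong suc (count-Ico n zero hi hi≤n)
  count-Ico (suc n) (suc lo) (suc hi) (s≤s hi≤n) = count-Ico n lo hi hi≤n

  greatest : ∀ {n} (p : Fin n → Bool) →
             (∀ m → p m ≡ false) ⊎ (Σ[ m ∈ Fin n ] (p m ≡ true × (∀ m′ → p m′ ≡ true → toℕ m′ ≤ toℕ m)))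
  greatest {zero}  p = inj₁ (λ ())
  greatest {suc n} p with greatest (p ∘ fs) | p fz in p0
  ... | inj₂ (m , pm , max) | _ = inj₂ (fs m , pm , λ { fz _ → z≤n ; (fs m′) pm′ → s≤s (max m′ pm′) })
  ... | inj₁ none | true  = inj₂ (fz , p0 , λ { fz _ → z≤n ; (fs m′) pm′ → contradiction (trans (sym pm′) (none m′)) λ () })
  ... | inj₁ none | false = inj₁ (λ { fz → p0 ; (fs m′) → none m′ })

  least : ∀ {n} (p : Fin n → Bool) →
          (∀ m → p m ≡ false) ⊎ (Σ[ m ∈ Fin n ] (p m ≡ true × (∀ m′ → p m′ ≡ true → toℕ m ≤ toℕ m′)))
  least {zero}  p = inj₁ (λ ())
  least {suc n} p with p fz in p0 | least (p ∘ fs)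
  ... | true  | _                   = inj₂ (fz , p0 , λ _ _ → z≤n)
  ... | false | inj₁ none           = inj₁ (λ { fz → p0 ; (fs m′) → none m′ })
  ... | false | inj₂ (m , pm , min) = inj₂ (fs m , pm , λ { fz pm′ → contradiction (trans (sym pm′) p0) λ () ; (fs m′) pm′ → s≤s (min m′ pm′) })

  ≤count⇒injection : ∀ n (p : Fin n → Bool) K → K ≤ count n p →
                     Σ[ f ∈ (Fin K → Fin n) ] (Injective _≡_ _≡_ f × (∀ j → p (f j) ≡ true))
  ≤count⇒injection n       p zero    _ = (λ ()) , (λ { {()} }) , λ ()
  ≤count⇒injection zero    p (suc K) ()
  ≤count⇒injection (suc n) p (suc K) K<c with p fz in p0 | ≤count⇒injection n (p ∘ fs)
  ... | true  | rest with rest K (≤-pred K<c)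
  ...   | f , f-inj , pf = g , g-inj , pg
    where
    g : Fin (suc K) → Fin (suc n)
    g fz     = fz
    g (fs j) = fs (f j)
    g-inj : Injective _≡_ _≡_ g
    g-inj {fz}   {fz}    _  = refl
    g-inj {fs j} {fs j′} eq = cong fs (f-inj (fs-injective eq))
    pg : ∀ j → p (g j) ≡ true
    pg fz     = p0
    pg (fs j) = pf j
  ≤count⇒injection (suc n) p (suc K) K<c | false | rest with rest (suc K) K<c
  ...   | f , f-inj , pf = fs ∘ f , f-inj ∘ fs-injective , pf

  ⌈/2⌉≤ : ∀ d x → d ≤ x + ⌊ d /2⌋ → ⌈ d /2⌉ ≤ x
  ⌈/2⌉≤ d x d≤ = +-cancelʳ-≤ ⌊ d /2⌋ ⌈ d /2⌉ x (begin
    ⌈ d /2⌉ + ⌊ d /2⌋ ≡⟨ +-comm ⌈ d /2⌉ _ ⟩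
    ⌊ d /2⌋ + ⌈ d /2⌉ ≡⟨ ⌊n/2⌋+⌈n/2⌉≡n d ⟩
    d                 ≤⟨ d≤ ⟩
    x + ⌊ d /2⌋       ∎)
    where open ≤-Reasoning

  ≤⌊/2⌋ : ∀ e p q → p + q ≤ e → ⌈ e /2⌉ ≤ q → p ≤ ⌊ e /2⌋
  ≤⌊/2⌋ e p q p+q≤e ⌈e/2⌉≤q = +-cancelʳ-≤ ⌈ e /2⌉ p ⌊ e /2⌋ (begin
    p + ⌈ e /2⌉       ≤⟨ +-monoʳ-≤ p ⌈e/2⌉≤q ⟩
    p + q             ≤⟨ p+q≤e ⟩
    e                 ≡⟨ sym (⌊n/2⌋+⌈n/2⌉≡n e) ⟩
    ⌊ e /2⌋ + ⌈ e /2⌉ ∎)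
    where open ≤-Reasoning

  count-≤⌊/2⌋ : ∀ n e (I p q : Fin n → Bool) → count n I ≡ e →
                (∀ m → p m ≡ true → I m ≡ true) → (∀ m → q m ≡ true → I m ≡ true) →
                (∀ m → p m ≡ true → q m ≡ false) → ⌈ e /2⌉ ≤ count n q → count n p ≤ ⌊ e /2⌋
  count-≤⌊/2⌋ n e I p q |I|≡e p⊆I q⊆I p∩q=∅ = ≤⌊/2⌋ e (count n p) (count n q) (begin
    count n p + count n q           ≤⟨ count-∨-disjoint n p q p∩q=∅ ⟩
    count n (λ m → p m ∨ q m)       ≤⟨ count-mono n p∨q⊆I ⟩
    count n I                       ≡⟨ |I|≡e ⟩
    e                               ∎)
    where
    open ≤-Reasoning
    p∨q⊆I : ∀ m → p m ∨ q m ≡ true → I m ≡ true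
    p∨q⊆I m p∨q with p m in pm
    ... | true  = p⊆I m pm
    ... | false = q⊆I m p∨q

  ⌈/2⌉≤+⇒< : ∀ d g c K → ⌈ d /2⌉ ≤ g + c → (c + K) + (c + K) < d → K < g
  ⌈/2⌉≤+⇒< d g c K ⌈d/2⌉≤g+c 2[c+K]<d = +-cancelˡ-≤ c (suc K) g (begin
    c + suc K                           ≡⟨ +-suc c K ⟩
    suc (c + K)                         ≡⟨ cong suc (n≡⌊n+n/2⌋ (c + K)) ⟩
    ⌈ suc ((c + K) + (c + K)) /2⌉       ≤⟨ ⌈n/2⌉-mono 2[c+K]<d ⟩
    ⌈ d /2⌉                             ≤⟨ ⌈d/2⌉≤g+c ⟩
    g + c                               ≡⟨ +-comm g c ⟩
    c + g                               ∎)
    where open ≤-Reasoning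

  m+[1+n]<o⇒n<o∸[1+m] : ∀ m n o → m + suc n < o → n < o ∸ suc m
  m+[1+n]<o⇒n<o∸[1+m] m n o m+[1+n]<o = m+n≤o⇒m≤o∸n (suc n) (begin
    suc n + suc m   ≡⟨ cong suc (+-comm n (suc m)) ⟩
    suc (suc m + n) ≡⟨ cong suc (sym (+-suc m n)) ⟩
    suc (m + suc n) ≤⟨ m+[1+n]<o ⟩
    o               ∎)
    where open ≤-Reasoning

module Detours {n} (A : Adj n) (T : Subset n) (σ : Fin n → Fin n) where

  open import Data.Nat using (suc; _+_; _∸_; _≤_; _<_; z≤n; s≤s; _<ᵇ_; _≤ᵇ_; ⌊_/2⌋; ⌈_/2⌉)
  open import Data.Nat.Properties
  open import Data.Integer as ℤ using (+_; -[1+_]; -≤+)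
  open import Data.Bool using (Bool; true; false; if_then_else_; _∧_; _∨_; not)
  open import Data.Bool.Properties using (∧-zeroʳ; not-injective)
  open import Data.Fin.Properties using (toℕ<n; toℕ-injective)
  open import Data.List using (List; []; _∷_; length; tabulate)
  open import Data.List.Properties using (length-tabulate)
  open import Data.List.Membership.Propositional using (_∈_)
  open import Data.List.Membership.Propositional.Properties using (∈-++⁻; ∈-tabulate⁻)
  open import Data.List.Relation.Unary.Any using (here; there)
  open import Data.List.Relation.Unary.AllPairs using (AllPairs)
  open import Data.List.Relation.Unary.AllPairs.Properties using (tabulate⁺)
  open import Data.Product using (Σ-syntax; _×_; _,_; proj₁; proj₂)
  open import Data.Sum using (_⊎_; inj₁; inj₂)
  open import Data.Empty using (⊥)
  open import Function using (_∘_)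
  open import Function.Definitions using (Injective)
  open import Relation.Nullary using (¬_; contradiction)
  open import Relation.Binary.PropositionalEquality
  open Counting

  Arc : Fin n → Fin n → Bool
  Arc = Arcσ A σ

  between : Fin n → Fin n → Fin n → Bool
  between a b = Ico (suc (toℕ a)) (toℕ b)

  clear : Fin n → Fin n → Bool
  clear a b = not (terminalIn T σ a b)

  detour : Fin n → Fin n → Fin n → Bool
  detour a b x = between a b x ∧ (Arc a x ∧ Arc x b)

  between-elim : ∀ a b {x} → between a b x ≡ true → toℕ a < toℕ x × toℕ x < toℕ b
  between-elim a b = Ico-elim (suc (toℕ a)) (toℕ b)

  detour-elim : ∀ {a b x} → detour a b x ≡ true →
                (toℕ a < toℕ x × toℕ x < toℕ b) × Arc a x ≡ true × Arc x b ≡ true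
  detour-elim {a} {b} {x} d with ∧-true (between a b x) d
  ... | bx , arcs with ∧-true (Arc a x) arcs
  ... | ax , xb = between-elim a b bx , ax , xb

  clearNonOut : Fin n → Fin n → Fin n → Bool
  clearNonOut a b x = between a b x ∧ (not (Arc a x) ∧ clear a x)

  clearNonIn : Fin n → Fin n → Fin n → Bool
  clearNonIn a b x = between a b x ∧ (not (Arc x b) ∧ clear x b)

  clearNonOut-elim : ∀ a b {x} → clearNonOut a b x ≡ true →
                     (toℕ a < toℕ x × toℕ x < toℕ b) × Arc a x ≡ false × clear a x ≡ true
  clearNonOut-elim a b {x} e with ∧-true (between a b x) e
  ... | bx , rest with ∧-true (not (Arc a x)) rest
  ... | ¬ax , clr = between-elim a b bx , not-injective ¬ax , clr

  clearNonIn-elim : ∀ a b {x} → clearNonIn a b x ≡ true →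
                    (toℕ a < toℕ x × toℕ x < toℕ b) × Arc x b ≡ false × clear x b ≡ true
  clearNonIn-elim a b {x} e with ∧-true (between a b x) e
  ... | bx , rest with ∧-true (not (Arc x b)) rest
  ... | ¬xb , clr = between-elim a b bx , not-injective ¬xb , clr

  inIv-intro : ∀ (a b : Fin n) {m} → toℕ a ≤ toℕ m → toℕ m ≤ toℕ b → inIv a b m ≡ true
  inIv-intro a b a≤m m≤b = cong₂ _∧_ (P⇒true (≤ᵇ-reflects-≤ _ _) a≤m) (P⇒true (≤ᵇ-reflects-≤ _ _) m≤b)

  inIv-elim : ∀ (a b : Fin n) {m} → inIv a b m ≡ true → toℕ a ≤ toℕ m × toℕ m ≤ toℕ b
  inIv-elim a b {m} m∈ with ∧-true (toℕ a ≤ᵇ toℕ m) m∈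
  ... | a≤m , m≤b = true⇒P (≤ᵇ-reflects-≤ _ _) a≤m , true⇒P (≤ᵇ-reflects-≤ _ _) m≤b

  terminalIn-intro : ∀ {a b m : Fin n} → T (σ m) ≡ true → toℕ a ≤ toℕ m → toℕ m ≤ toℕ b → terminalIn T σ a b ≡ true
  terminalIn-intro {a} {b} {m} tm a≤m m≤b
    with count n (λ x → inIv a b x ∧ T (σ x)) | count-pos n (λ x → inIv a b x ∧ T (σ x)) m (cong₂ _∧_ (inIv-intro a b a≤m m≤b) tm)
  ... | suc _ | _ = refl

  clear⇒NonTerminal : ∀ {a b : Fin n} → clear a b ≡ true → NonTerminal T σ a b
  clear⇒NonTerminal {a} {b} clr m a≤m m≤b with T (σ m) in tm
  ... | false = refl
  ... | true  = contradiction (trans (sym (cong not (terminalIn-intro tm a≤m m≤b))) clr) λ ()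

  affected-out+into≤cost : ∀ u v (S : Fin n → Bool) → S u ≡ false →
    count n (affected A T σ u) + count n (λ x → S x ∧ affected A T σ x v) ≤ cost A T σ
  affected-out+into≤cost u v S Su = term+sumF≤sumF n (λ x → count n (affected A T σ x)) _ u g≡0 g≤
    where
    g≡0 : (if S u ∧ affected A T σ u v then 1 else 0) ≡ 0
    g≡0 rewrite Su = refl
    g≤ : ∀ x → (if S x ∧ affected A T σ x v then 1 else 0) ≤ count n (affected A T σ x)
    g≤ x with S x ∧ affected A T σ x v in e
    ... | false = z≤n
    ... | true  = count-pos n _ v (proj₂ (∧-true (S x) e))

  charged : Fin n → Fin n → Fin n → Bool
  charged a b x = affected A T σ b x ∨ (between a b x ∧ affected A T σ x a)

  uncharged : Fin n → Fin n → Fin n → Bool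
  uncharged a b x = clearNonOut a b x ∨ clearNonIn a b x

  count-charged≤cost : ∀ a b → count n (charged a b) ≤ cost A T σ
  count-charged≤cost a b = ≤-trans (count-∨ n _ _) (affected-out+into≤cost b a (between a b) b∉)
    where
    b∉ : between a b b ≡ false
    b∉ = cong (_∧ not (toℕ b <ᵇ suc (toℕ a))) (¬P⇒false (<ᵇ-reflects-< _ _) (n≮n (toℕ b)))

  clearNonOut-empty : ∀ a b → T (σ a) ≡ true → ∀ x → clearNonOut a b x ≡ false
  clearNonOut-empty a b Ta x = case-bool (between a b x)
    (λ bx → trans (cong₂ _∧_ bx (cong (not (Arc a x) ∧_) (cong not
                    (terminalIn-intro Ta ≤-refl (<⇒≤ (proj₁ (between-elim a b bx)))))))
                  (∧-zeroʳ (not (Arc a x))))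
    (λ bx → cong (_∧ (not (Arc a x) ∧ clear a x)) bx)

  clearNonIn-empty : ∀ a b → T (σ b) ≡ true → ∀ x → clearNonIn a b x ≡ false
  clearNonIn-empty a b Tb x = case-bool (between a b x)
    (λ bx → trans (cong₂ _∧_ bx (cong (not (Arc x b) ∧_) (cong not
                    (terminalIn-intro Tb (<⇒≤ (proj₂ (between-elim a b bx))) ≤-refl))))
                  (∧-zeroʳ (not (Arc x b))))
    (λ bx → cong (_∧ (not (Arc x b) ∧ clear x b)) bx)

  module _ (tournament : IsTournament A) (σ-injective : Injective _≡_ _≡_ σ) where

    arc-reverse : ∀ {u v} → toℕ u ≢ toℕ v → Arc u v ≡ false → Arc v u ≡ true
    arc-reverse {u} {v} u≢v uv with proj₂ tournament (σ u) (σ v) (u≢v ∘ cong toℕ ∘ σ-injective)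
    ... | inj₁ (uv′ , _) = contradiction (trans (sym uv′) uv) λ ()
    ... | inj₂ (_ , vu)  = vu

    -- A vertex of (a, b) that is not a detour misses the arc from a or the arc to b; the
    -- reverse arc is backward, and it is affected unless the interval it spans is clear.
    classify : ∀ a b x → between a b x ≡ true → detour a b x ∨ (charged a b x ∨ uncharged a b x) ≡ true
    classify a b x bx =
      case-bool (Arc x b) (λ xb → case-bool (Arc a x) (λ ax → via-detour ax xb) missing-from-a) missing-into-b
      where
      a<x = proj₁ (between-elim a b bx)
      x<b = proj₂ (between-elim a b bx)
      via-detour : Arc a x ≡ true → Arc x b ≡ true → detour a b x ∨ (charged a b x ∨ uncharged a b x) ≡ true
      via-detour ax xb = ∨-introˡ (detour a b x) _ (cong₂ _∧_ bx (cong₂ _∧_ ax xb))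
      via-charged : charged a b x ≡ true → detour a b x ∨ (charged a b x ∨ uncharged a b x) ≡ true
      via-charged c = ∨-introʳ (detour a b x) _ (∨-introˡ (charged a b x) _ c)
      via-uncharged : uncharged a b x ≡ true → detour a b x ∨ (charged a b x ∨ uncharged a b x) ≡ true
      via-uncharged u = ∨-introʳ (detour a b x) _ (∨-introʳ (charged a b x) _ u)
      missing-into-b : Arc x b ≡ false → detour a b x ∨ (charged a b x ∨ uncharged a b x) ≡ true
      missing-into-b xb = case-bool (terminalIn T σ x b)
        (λ txb → via-charged (∨-introˡ (affected A T σ b x) _
          (cong₂ _∧_ (arc-reverse (<⇒≢ x<b) xb) (cong₂ _∧_ (P⇒true (<ᵇ-reflects-< _ _) x<b) txb))))
        (λ txb → via-uncharged (∨-introʳ (clearNonOut a b x) _ (cong₂ _∧_ bx (cong₂ _∧_ (cong not xb) (cong not txb)))))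
      missing-from-a : Arc a x ≡ false → detour a b x ∨ (charged a b x ∨ uncharged a b x) ≡ true
      missing-from-a ax = case-bool (terminalIn T σ a x)
        (λ tax → via-charged (∨-introʳ (affected A T σ b x) _
          (cong₂ _∧_ bx (cong₂ _∧_ (arc-reverse (<⇒≢ a<x) ax) (cong₂ _∧_ (P⇒true (<ᵇ-reflects-< _ _) a<x) tax)))))
        (λ tax → via-uncharged (∨-introˡ (clearNonOut a b x) _ (cong₂ _∧_ bx (cong₂ _∧_ (cong not ax) (cong not tax)))))

  module _ (loopless : ∀ v → A v v ≡ false) (regular : Regular A T σ) where

    count-clearNonOut≤ : ∀ a b → count n (clearNonOut a b) ≤ ⌊ toℕ b ∸ suc (toℕ a) /2⌋
    count-clearNonOut≤ a b with greatest (clearNonOut a b)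
    ... | inj₁ none = ≤-trans (≤-reflexive (count-none n (clearNonOut a b) none)) z≤n
    ... | inj₂ (z , Nz , maximal) with clearNonOut-elim a b Nz
    ...   | (a<z , z<b) , _ , clear-az = ≤-trans
            (count-≤⌊/2⌋ n (toℕ z ∸ toℕ a) (Ico (suc (toℕ a)) (suc (toℕ z))) (clearNonOut a b) out
               (count-Ico n (suc (toℕ a)) (suc (toℕ z)) (toℕ<n z)) N⊆ out⊆ N∩out=∅
               (proj₁ (regular a z (<⇒≤ a<z) (clear⇒NonTerminal clear-az))))
            (⌊n/2⌋-mono (∸-monoˡ-≤ (suc (toℕ a)) z<b))
      where
      out : Fin n → Bool
      out m = inIv a z m ∧ Arc a m
      N⊆ : ∀ m → clearNonOut a b m ≡ true → Ico (suc (toℕ a)) (suc (toℕ z)) m ≡ true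
      N⊆ m Nm = Ico-intro (suc (toℕ a)) (suc (toℕ z)) (proj₁ (proj₁ (clearNonOut-elim a b Nm))) (s≤s (maximal m Nm))
      out⊆ : ∀ m → out m ≡ true → Ico (suc (toℕ a)) (suc (toℕ z)) m ≡ true
      out⊆ m om with ∧-true (inIv a z m) om
      ... | m∈ , am = Ico-intro (suc (toℕ a)) (suc (toℕ z)) (≤∧≢⇒< (proj₁ (inIv-elim a z m∈)) a≢m) (s≤s (proj₂ (inIv-elim a z m∈)))
        where
        a≢m : toℕ a ≢ toℕ m
        a≢m a≡m with toℕ-injective a≡m
        ... | refl = contradiction (trans (sym am) (loopless (σ a))) λ ()
      N∩out=∅ : ∀ m → clearNonOut a b m ≡ true → out m ≡ false
      N∩out=∅ m Nm = trans (cong (inIv a z m ∧_) (proj₁ (proj₂ (clearNonOut-elim a b Nm)))) (∧-zeroʳ _)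

    count-clearNonIn≤ : ∀ a b → count n (clearNonIn a b) ≤ ⌊ toℕ b ∸ suc (toℕ a) /2⌋
    count-clearNonIn≤ a b with least (clearNonIn a b)
    ... | inj₁ none = ≤-trans (≤-reflexive (count-none n (clearNonIn a b) none)) z≤n
    ... | inj₂ (z , Nz , minimal) with clearNonIn-elim a b Nz
    ...   | (a<z , z<b) , _ , clear-zb = ≤-trans
            (count-≤⌊/2⌋ n (toℕ b ∸ toℕ z) (Ico (toℕ z) (toℕ b)) (clearNonIn a b) into
               (count-Ico n (toℕ z) (toℕ b) (<⇒≤ (toℕ<n b))) N⊆ into⊆ N∩into=∅
               (proj₂ (regular z b (<⇒≤ z<b) (clear⇒NonTerminal clear-zb))))
            (⌊n/2⌋-mono (∸-monoʳ-≤ (toℕ b) a<z))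
      where
      into : Fin n → Bool
      into m = inIv z b m ∧ Arc m b
      N⊆ : ∀ m → clearNonIn a b m ≡ true → Ico (toℕ z) (toℕ b) m ≡ true
      N⊆ m Nm = Ico-intro (toℕ z) (toℕ b) (minimal m Nm) (proj₂ (proj₁ (clearNonIn-elim a b Nm)))
      into⊆ : ∀ m → into m ≡ true → Ico (toℕ z) (toℕ b) m ≡ true
      into⊆ m im with ∧-true (inIv z b m) im
      ... | m∈ , mb = Ico-intro (toℕ z) (toℕ b) (proj₁ (inIv-elim z b m∈)) (≤∧≢⇒< (proj₂ (inIv-elim z b m∈)) m≢b)
        where
        m≢b : toℕ m ≢ toℕ b
        m≢b m≡b with toℕ-injective m≡b
        ... | refl = contradiction (trans (sym mb) (loopless (σ m))) λ ()
      N∩into=∅ : ∀ m → clearNonIn a b m ≡ true → into m ≡ false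
      N∩into=∅ m Nm = trans (cong (inIv z b m ∧_) (proj₁ (proj₂ (clearNonIn-elim a b Nm)))) (∧-zeroʳ _)

    count-uncharged≤ : ∀ a b → T (σ a) ≡ true ⊎ T (σ b) ≡ true →
                       count n (uncharged a b) ≤ ⌊ toℕ b ∸ suc (toℕ a) /2⌋
    count-uncharged≤ a b terminal = ≤-trans (count-∨ n (clearNonOut a b) (clearNonIn a b)) (one-side terminal)
      where
      one-side : T (σ a) ≡ true ⊎ T (σ b) ≡ true →
                 count n (clearNonOut a b) + count n (clearNonIn a b) ≤ ⌊ toℕ b ∸ suc (toℕ a) /2⌋
      one-side (inj₁ Ta) rewrite count-none n (clearNonOut a b) (clearNonOut-empty a b Ta) = count-clearNonIn≤ a b
      one-side (inj₂ Tb) rewrite count-none n (clearNonIn a b) (clearNonIn-empty a b Tb) | +-identityʳ (count n (clearNonOut a b)) = count-clearNonOut≤ a b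

  module Routes (l i r : Fin n) where

    route : Fin n → Fin n → List (Fin n)
    route x y = l ∷ x ∷ i ∷ y ∷ r ∷ []

    route-forward : ∀ {x y} → detour l i x ≡ true → detour i r y ≡ true → FwdPath A σ l r (route x y)
    route-forward dx dy with detour-elim dx | detour-elim dy
    ... | (l<x , x<i) , lx , xi | (i<y , y<r) , iy , yr =
      step lx l<x (step xi x<i (step iy i<y (step yr y<r (here r))))

    hop : Fin n → Fin n → Fin n → List (Fin n × Fin n)
    hop a x b = (a , x) ∷ (x , b) ∷ []

    hop-tail : ∀ {a x b e} → toℕ a < toℕ x → toℕ x < toℕ b → e ∈ hop a x b →
               toℕ a ≤ toℕ (proj₁ e) × toℕ (proj₁ e) < toℕ b
    hop-tail a<x x<b (here refl)         = ≤-refl , <-trans a<x x<b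
    hop-tail a<x x<b (there (here refl)) = <⇒≤ a<x , x<b

    hop-middle : ∀ {a x x′ b e} → toℕ a < toℕ x → toℕ a < toℕ x′ → e ∈ hop a x b → e ∈ hop a x′ b → x ≡ x′
    hop-middle _   _    (here refl)         (here refl)         = refl
    hop-middle _   a<x′ (here refl)         (there (here refl)) = contradiction a<x′ (<-irrefl refl)
    hop-middle a<x _    (there (here refl)) (here refl)         = contradiction a<x (<-irrefl refl)
    hop-middle _   _    (there (here refl)) (there (here refl)) = refl

    -- The arcs of a route are those of the hop l → x → i followed by those of i → y → r,
    -- and i separates their tails.
    routes-disjoint : ∀ {x x′ y y′} → detour l i x ≡ true → detour l i x′ ≡ true →
                      detour i r y ≡ true → detour i r y′ ≡ true → x ≢ x′ → y ≢ y′ →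
                      ArcDisjoint (route x y) (route x′ y′)
    routes-disjoint {x} {x′} dx dx′ dy dy′ x≢x′ y≢y′ e e∈ e∈′
      with detour-elim dx | detour-elim dx′ | detour-elim dy | detour-elim dy′
         | ∈-++⁻ (hop l x i) e∈ | ∈-++⁻ (hop l x′ i) e∈′
    ... | (l<x , _) , _ | (l<x′ , _) , _ | _ | _ | inj₁ p | inj₁ q = x≢x′ (hop-middle l<x l<x′ p q)
    ... | _ | _ | (i<y , _) , _ | (i<y′ , _) , _ | inj₂ p | inj₂ q = y≢y′ (hop-middle i<y i<y′ p q)
    ... | (l<x , x<i) , _ | _ | _ | (i<y′ , y′<r) , _ | inj₁ p | inj₂ q =
      <⇒≱ (proj₂ (hop-tail l<x x<i p)) (proj₁ (hop-tail i<y′ y′<r q))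
    ... | _ | (l<x′ , x′<i) , _ | (i<y , y<r) , _ | _ | inj₂ p | inj₁ q =
      <⇒≱ (proj₂ (hop-tail l<x′ x′<i q)) (proj₁ (hop-tail i<y y<r p))

    many-routes : ∀ K (xs ys : Fin (suc K) → Fin n) → Injective _≡_ _≡_ xs → Injective _≡_ _≡_ ys →
                  (∀ j → detour l i (xs j) ≡ true) → (∀ j → detour i r (ys j) ≡ true) →
                  Σ[ Ps ∈ List (List (Fin n)) ] ((+ length Ps ≡ + K ℤ.+ + 1) ×
                    (∀ P → P ∈ Ps → FwdPath A σ l r P × i ∈ P) × AllPairs ArcDisjoint Ps)
    many-routes K xs ys xs-inj ys-inj dxs dys =
      tabulate paths ,
      cong +_ (trans (length-tabulate paths) (+-comm 1 K)) ,
      on-route ,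
      tabulate⁺ {f = paths} (λ {j} {j′} j≢j′ → routes-disjoint (dxs j) (dxs j′) (dys j) (dys j′) (j≢j′ ∘ xs-inj) (j≢j′ ∘ ys-inj))
      where
      paths : Fin (suc K) → List (Fin n)
      paths j = route (xs j) (ys j)
      on-route : ∀ P → P ∈ tabulate paths → FwdPath A σ l r P × i ∈ P
      on-route P P∈ with ∈-tabulate⁻ {f = paths} P∈
      ... | j , refl = route-forward (dxs j) (dys j) , there (there (here refl))

  module _ (tournament : IsTournament A) (σ-injective : Injective _≡_ _≡_ σ) (regular : Regular A T σ) where

    ⌈gap/2⌉≤detours+cost : ∀ a b → T (σ a) ≡ true ⊎ T (σ b) ≡ true →
                ⌈ toℕ b ∸ suc (toℕ a) /2⌉ ≤ count n (detour a b) + cost A T σ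
    ⌈gap/2⌉≤detours+cost a b terminal = ⌈/2⌉≤ d (count n (detour a b) + cost A T σ) (begin
      d                                                       ≡⟨ sym (count-Ico n (suc (toℕ a)) (toℕ b) (<⇒≤ (toℕ<n b))) ⟩
      count n (between a b)                                   ≤⟨ count-mono n (classify tournament σ-injective a b) ⟩
      count n (λ x → detour a b x ∨ (charged a b x ∨ uncharged a b x))
                                                              ≤⟨ count-∨ n (detour a b) (λ x → charged a b x ∨ uncharged a b x) ⟩
      g + count n (λ x → charged a b x ∨ uncharged a b x)     ≤⟨ +-monoʳ-≤ g (count-∨ n (charged a b) (uncharged a b)) ⟩
      g + (count n (charged a b) + count n (uncharged a b))   ≤⟨ +-monoʳ-≤ g (+-mono-≤ (count-charged≤cost a b)
                                                                   (count-uncharged≤ (proj₁ tournament) regular a b terminal)) ⟩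
      g + (cost A T σ + ⌊ d /2⌋)                              ≡⟨ sym (+-assoc g (cost A T σ) ⌊ d /2⌋) ⟩
      g + cost A T σ + ⌊ d /2⌋                                ∎)
      where
      open ≤-Reasoning
      d = toℕ b ∸ suc (toℕ a)
      g = count n (detour a b)

    many-detours : ∀ K a b → T (σ a) ≡ true ⊎ T (σ b) ≡ true →
                   (cost A T σ + K) + (cost A T σ + K) < toℕ b ∸ suc (toℕ a) → K < count n (detour a b)
    many-detours K a b terminal = ⌈/2⌉≤+⇒< _ _ (cost A T σ) K (⌈gap/2⌉≤detours+cost a b terminal)

    no-deep-terminal : ∀ K → Reduced A T (+ K) σ → ∀ i l r → T (σ i) ≡ true → Arc r l ≡ true →
                       toℕ l < toℕ r → toℕ l ≤ toℕ i → toℕ i ≤ toℕ r →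
                       (cost A T σ + K) + (cost A T σ + K) < toℕ i ∸ suc (toℕ l) →
                       (cost A T σ + K) + (cost A T σ + K) < toℕ r ∸ suc (toℕ i) → ⊥
    no-deep-terminal K reduced i l r Ti rl l<r l≤i i≤r wide-l wide-r
      with ≤count⇒injection n (detour l i) (suc K) (many-detours K l i (inj₂ Ti) wide-l)
         | ≤count⇒injection n (detour i r) (suc K) (many-detours K i r (inj₁ Ti) wide-r)
    ... | xs , xs-inj , dxs | ys , ys-inj , dys =
      proj₂ (proj₂ (proj₂ reduced)) r l i rl l<r l≤i i≤r Ti (many-routes K xs ys xs-inj ys-inj dxs dys)
      where open Routes l i r

  negative-k-not-reduced : ∀ {m} → Fin n → ¬ Reduced A T -[1+ m ] σ
  negative-k-not-reduced v (no-cycle , _ , on-cycle , _) with on-cycle v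
  ... | C , tcycle , _ = no-cycle (-≤+ , C , tcycle)

module Embedding where

  open import Data.Nat as ℕ using (ℕ; s≤s; z≤n)
  open import Data.Integer as ℤ using (+_; +≤+)
  import Data.Integer.Properties as ℤ
  open import Data.Nat.Coprimality using (1-coprimeTo) renaming (sym to coprime-sym)
  open import Data.Rational using (ℚ; mkℚ; 1ℚ; _+_; _*_; _-_; -_; _≤_; _<_; *≤*; *<*)
  open import Data.Rational.Properties
  import Data.Rational.Unnormalised as ℚᵘ
  import Data.Rational.Unnormalised.Properties as ℚᵘ
  open import Data.Rational.Solver using (module +-*-Solver)
  open import Data.Product using (_×_; _,_)
  open import Data.Sum using (_⊎_; inj₁; inj₂)
  open import Relation.Nullary using (yes; no)
  open import Relation.Binary.PropositionalEquality

  ℕ→ℚ-normal : ℕ → ℚ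
  ℕ→ℚ-normal m = mkℚ (+ m) 0 (coprime-sym (1-coprimeTo m))

  ℕ→ℚ≡ℕ→ℚ-normal : ∀ m → ℕ→ℚ m ≡ ℕ→ℚ-normal m
  ℕ→ℚ≡ℕ→ℚ-normal m = normalize-coprime _

  ℕ→ℚ-+ : ∀ m n → ℕ→ℚ (m ℕ.+ n) ≡ ℕ→ℚ m + ℕ→ℚ n
  ℕ→ℚ-+ m n rewrite ℕ→ℚ≡ℕ→ℚ-normal m | ℕ→ℚ≡ℕ→ℚ-normal n | ℕ→ℚ≡ℕ→ℚ-normal (m ℕ.+ n) =
    toℚᵘ-injective (ℚᵘ.≃-trans sum (ℚᵘ.≃-sym (toℚᵘ-homo-+ (ℕ→ℚ-normal m) (ℕ→ℚ-normal n))))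
    where
    sum : ℚᵘ.mkℚᵘ (+ (m ℕ.+ n)) 0 ℚᵘ.≃ ℚᵘ.mkℚᵘ (+ m) 0 ℚᵘ.+ ℚᵘ.mkℚᵘ (+ n) 0
    sum = ℚᵘ.*≡* (trans (ℤ.*-identityʳ _)
                  (sym (trans (ℤ.*-identityʳ _) (cong₂ ℤ._+_ (ℤ.*-identityʳ (+ m)) (ℤ.*-identityʳ (+ n))))))

  ℕ→ℚ-mono-≤ : ∀ {m n} → m ℕ.≤ n → ℕ→ℚ m ≤ ℕ→ℚ n
  ℕ→ℚ-mono-≤ {m} {n} m≤n rewrite ℕ→ℚ≡ℕ→ℚ-normal m | ℕ→ℚ≡ℕ→ℚ-normal n =
    *≤* (subst₂ ℤ._≤_ (sym (ℤ.*-identityʳ (+ m))) (sym (ℤ.*-identityʳ (+ n))) (+≤+ m≤n))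

  ℕ→ℚ-cancel-< : ∀ {m n} → ℕ→ℚ m < ℕ→ℚ n → m ℕ.< n
  ℕ→ℚ-cancel-< {m} {n} m<n rewrite ℕ→ℚ≡ℕ→ℚ-normal m | ℕ→ℚ≡ℕ→ℚ-normal n with m<n
  ... | *<* m<n′ = ℤ.drop‿+<+ (subst₂ ℤ._<_ (ℤ.*-identityʳ (+ m)) (ℤ.*-identityʳ (+ n)) m<n′)

  ℓ-bound : ∀ ρ c K → ℕ→ℚ c ≤ ρ * ℤ→ℚ (+ K) →
            ℕ→ℚ (ℕ.suc ((c ℕ.+ K) ℕ.+ (c ℕ.+ K))) ≤ ℕ→ℚ 2 * (ρ + 1ℚ) * ℤ→ℚ (+ K) + ℕ→ℚ 2
  ℓ-bound ρ c K c≤ρK = begin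
    ℕ→ℚ (1 ℕ.+ ((c ℕ.+ K) ℕ.+ (c ℕ.+ K)))           ≡⟨ trans (ℕ→ℚ-+ 1 ((c ℕ.+ K) ℕ.+ (c ℕ.+ K))) (cong (_+_ (ℕ→ℚ 1)) (ℕ→ℚ-+ (c ℕ.+ K) (c ℕ.+ K))) ⟩
    ℕ→ℚ 1 + (ℕ→ℚ (c ℕ.+ K) + ℕ→ℚ (c ℕ.+ K))         ≤⟨ +-mono-≤ (ℕ→ℚ-mono-≤ {1} {2} (s≤s z≤n)) (+-mono-≤ c+K≤ c+K≤) ⟩
    ℕ→ℚ 2 + ((ρ * ℤ→ℚ (+ K) + ℤ→ℚ (+ K)) + (ρ * ℤ→ℚ (+ K) + ℤ→ℚ (+ K))) ≡⟨ expand ρ (ℤ→ℚ (+ K)) ⟩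
    ℕ→ℚ 2 * (ρ + 1ℚ) * ℤ→ℚ (+ K) + ℕ→ℚ 2            ∎
    where
    open ≤-Reasoning
    open +-*-Solver
    c+K≤ : ℕ→ℚ (c ℕ.+ K) ≤ ρ * ℤ→ℚ (+ K) + ℤ→ℚ (+ K)
    c+K≤ = subst (_≤ ρ * ℤ→ℚ (+ K) + ℤ→ℚ (+ K)) (sym (ℕ→ℚ-+ c K)) (+-monoˡ-≤ (ℤ→ℚ (+ K)) c≤ρK)
    expand : ∀ ρ K → ℕ→ℚ 2 + ((ρ * K + K) + (ρ * K + K)) ≡ ℕ→ℚ 2 * (ρ + 1ℚ) * K + ℕ→ℚ 2
    expand = solve 2 (λ ρ K → con (ℕ→ℚ 2) :+ ((ρ :* K :+ K) :+ (ρ :* K :+ K))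
                             := con (ℕ→ℚ 2) :* (ρ :+ con 1ℚ) :* K :+ con (ℕ→ℚ 2)) refl

  near-an-end-or-far : ∀ (ℓ : ℚ) l i r → l ℕ.≤ i → i ℕ.≤ r →
    (ℕ→ℚ l ≤ ℕ→ℚ i × ℕ→ℚ i ≤ ℕ→ℚ l + ℓ) ⊎ (ℕ→ℚ r - ℓ ≤ ℕ→ℚ i × ℕ→ℚ i ≤ ℕ→ℚ r) ⊎
    (ℕ→ℚ l + ℓ < ℕ→ℚ i × ℕ→ℚ i + ℓ < ℕ→ℚ r)
  near-an-end-or-far ℓ l i r l≤i i≤r with ℕ→ℚ i ≤? ℕ→ℚ l + ℓ | ℕ→ℚ r - ℓ ≤? ℕ→ℚ i
  ... | yes near-l | _          = inj₁ (ℕ→ℚ-mono-≤ l≤i , near-l)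
  ... | no _       | yes near-r = inj₂ (inj₁ (near-r , ℕ→ℚ-mono-≤ i≤r))
  ... | no far-l   | no far-r   = inj₂ (inj₂ (≰⇒> far-l , subst (ℕ→ℚ i + ℓ <_) r-ℓ+ℓ≡r (+-monoˡ-< ℓ (≰⇒> far-r))))
    where
    r-ℓ+ℓ≡r : ℕ→ℚ r - ℓ + ℓ ≡ ℕ→ℚ r
    r-ℓ+ℓ≡r = trans (+-assoc (ℕ→ℚ r) (- ℓ) ℓ) (trans (cong (_+_ (ℕ→ℚ r)) (+-inverseˡ ℓ)) (+-identityʳ (ℕ→ℚ r)))

  ℕ→ℚ-+<⇒+< : ∀ {ℓ} g a b → ℕ→ℚ g ≤ ℓ → ℕ→ℚ a + ℓ < ℕ→ℚ b → a ℕ.+ g ℕ.< b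
  ℕ→ℚ-+<⇒+< {ℓ} g a b g≤ℓ a+ℓ<b =
    ℕ→ℚ-cancel-< (≤-<-trans (subst (_≤ ℕ→ℚ a + ℓ) (sym (ℕ→ℚ-+ a g)) (+-monoʳ-≤ (ℕ→ℚ a) g≤ℓ)) a+ℓ<b)

open import Data.Nat using (ℕ; _<_; _≤_)
open import Data.Integer using (ℤ)
open import Data.Rational using (ℚ; 1ℚ; _+_; _*_; _-_)
open import Data.Rational using () renaming (_≤_ to _≤ℚ_)
open import Data.Bool using (true)
open import Data.Sum using (_⊎_)
open import Data.Product using (_×_)
open import Relation.Binary.PropositionalEquality using (_≡_)
open import Function.Definitions using (Injective)

import Data.Nat as ℕ
open import Data.Integer using (+_; -[1+_])
open import Data.Rational using () renaming (_<_ to _<ℚ_)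
open import Data.Sum using (inj₁; inj₂; [_,_])
open import Data.Product using (proj₁; proj₂)
open import Data.Empty using (⊥-elim)
open Counting using (m+[1+n]<o⇒n<o∸[1+m])
open Embedding using (ℓ-bound; near-an-end-or-far; ℕ→ℚ-+<⇒+<)

-- The case analysis avoids with: abstracting over this goal
-- makes Agda normalise the rational terms in it.
lemma3 : (n : ℕ) (A : Adj n) (T : Subset n) (k : ℤ) (σ : Fin n → Fin n) (ρ : ℚ) →
    IsTournament A → Injective _≡_ _≡_ σ → 1ℚ ≤ℚ ρ →
    Regular A T σ → ℕ→ℚ (cost A T σ) ≤ℚ ρ * ℤ→ℚ k → Reduced A T k σ →
    (i l r : Fin n) → T (σ i) ≡ true →
    Arcσ A σ r l ≡ true → toℕ l < toℕ r → toℕ l ≤ toℕ i → toℕ i ≤ toℕ r →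
    let ℓ = ℕ→ℚ 2 * (ρ + 1ℚ) * ℤ→ℚ k + ℕ→ℚ 2 in
    (ℕ→ℚ (toℕ l) ≤ℚ ℕ→ℚ (toℕ i) × ℕ→ℚ (toℕ i) ≤ℚ ℕ→ℚ (toℕ l) + ℓ) ⊎
    (ℕ→ℚ (toℕ r) - ℓ ≤ℚ ℕ→ℚ (toℕ i) × ℕ→ℚ (toℕ i) ≤ℚ ℕ→ℚ (toℕ r))
lemma3 n A T (+ K) σ ρ tournament σ-injective _ regular cost≤ρk reduced i l r Ti rl l<r l≤i i≤r =
  [ inj₁ , [ inj₂ , (λ far → ⊥-elim (no-deep-terminal tournament σ-injective regular K reduced i l r Ti rl l<r l≤i i≤r
                                       (wide (toℕ l) (toℕ i) (proj₁ far)) (wide (toℕ i) (toℕ r) (proj₂ far)))) ] ]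
    (near-an-end-or-far (ℕ→ℚ 2 * (ρ + 1ℚ) * ℤ→ℚ (+ K) + ℕ→ℚ 2) (toℕ l) (toℕ i) (toℕ r) l≤i i≤r)
  where
  open Detours A T σ
  wide : ∀ a b → ℕ→ℚ a + (ℕ→ℚ 2 * (ρ + 1ℚ) * ℤ→ℚ (+ K) + ℕ→ℚ 2) <ℚ ℕ→ℚ b →
         (cost A T σ ℕ.+ K) ℕ.+ (cost A T σ ℕ.+ K) < b ℕ.∸ ℕ.suc a
  wide a b far = m+[1+n]<o⇒n<o∸[1+m] a _ b (ℕ→ℚ-+<⇒+< _ a b (ℓ-bound ρ (cost A T σ) K cost≤ρk) far)
lemma3 _ A T -[1+ _ ] σ _ _ _ _ _ _ reduced i _ _ _ _ _ _ _ =
  ⊥-elim (Detours.negative-k-not-reduced A T σ i reduced)
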